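{- Let $1\le k$ and $a\in[n]$ with $a+k-1\le n$, and let $\pi\in\mathfrak{S}_n$ be the increasing $k$-cycle $\langle a,a+1,\dots,a+k-1\rangle$, i.e. in one-line notation $\pi=(1,2,\dots,a-1,a+1,a+2,\dots,a+k-1,a,a+k,\dots,n)$. Then $|\mathcal{O}_{\mathrm{MVP}_n}^{ -1}(\pi)|=k$.
   Context: Spots $1,\dots,n$ on a one-way street; cars $1,\dots,n$ arrive in order with preferences $\alpha=(a_1,\dots,a_n)\in[n]^n$. MVP parking rule: when car $i$ arrives, if spot $a_i$ is unoccupied, car $i$ parks there; if spot $a_i$ is occupied by an earlier car $j$, then car $i$ parks in spot $a_i$ and car $j$ is bumped and parks in the first unoccupied spot among $a_i+1,\dots,n$, if any (otherwise car $j$ fails to park); a bumped car never bumps another car. $\alpha$ is an MVP parking function if all cars park; its outcome $\mathcal{O}_{\mathrm{MVP}_n}(\alpha)$ is the permutation (in one-line notation) whose $j$th entry is the car parked in spot $j$. $\mathcal{O}_{\mathrm{MVP}_n}^{ -1}(\pi)$ is the set of MVP parking functions of length $n$ with outcome $\pi$. -}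

module Defs where

open import Data.Nat using (ℕ; zero; suc; _+_; _∸_; _<_; _<?_; _≤?_)
open import Data.Fin using (Fin; toℕ)
open import Data.Vec using (Vec; []; _∷_; lookup; _[_]≔_; replicate; tabulate)
open import Data.List using (List; filter)
open import Data.List.Base using (head)
open import Data.Fin.Base using () 
open import Data.List using () renaming (allFin to allFinL)
open import Data.Maybe using (Maybe; just; nothing; is-nothing)
open import Data.Bool using (Bool; true; false; T; _∧_; if_then_else_)
open import Data.Product using (_×_)
open import Relation.Nullary.Decidable using (⌊_⌋; _×-dec_; yes; no)

-- Spots and cars are indexed by Fin n (0-based); spot s is spot (toℕ s + 1)
-- of the paper, car c is car (toℕ c + 1) of the paper.
-- An occupancy state records, for each spot, the car parked there (if any).
Occ : ℕ → Set
Occ n = Vec (Maybe (Fin n)) n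

isFree : ∀ {n} → Occ n → Fin n → Bool
isFree occ q = is-nothing (lookup occ q)

firstFreeAfter : ∀ {n} → Occ n → Fin n → Maybe (Fin n)
firstFreeAfter {n} occ p =
  head (filter (λ q → toℕ p <? toℕ q) (filter (λ q → T? (isFree occ q)) (allFinL n)))
  where
    open import Relation.Nullary.Decidable using () renaming (T? to T?)

-- MVP rule for one arriving car c with preferred spot p.
-- Result nothing = some car fails to park.
parkMVP : ∀ {n} → Occ n → Fin n → Fin n → Maybe (Occ n)
parkMVP occ c p with lookup occ p
... | nothing = just (occ [ p ]≔ just c)
... | just j with firstFreeAfter occ p
...   | nothing = nothing
...   | just q  = just ((occ [ p ]≔ just c) [ q ]≔ just j)

runMVP : ∀ {n m} → Occ n → Vec (Fin n) m → Vec (Fin n) m → Maybe (Occ n)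
runMVP occ [] [] = just occ
runMVP occ (c ∷ cs) (p ∷ ps) with parkMVP occ c p
... | nothing   = nothing
... | just occ′ = runMVP occ′ cs ps

allFinV : ∀ n → Vec (Fin n) n
allFinV n = tabulate (λ i → i)

allFilled : ∀ {n m} → Vec (Maybe (Fin n)) m → Maybe (Vec (Fin n) m)
allFilled [] = just []
allFilled (nothing ∷ xs) = nothing
allFilled (just c ∷ xs) with allFilled xs
... | nothing = nothing
... | just ys = just (c ∷ ys)

-- Outcome in one-line notation with cars labelled 1..n (as naturals):
-- just π if α is an MVP parking function with outcome π, nothing otherwise.
-- (If all n cars park, all n spots are filled.)
outcomeMVP : ∀ {n} → Vec (Fin n) n → Maybe (Vec ℕ n)
outcomeMVP {n} α with runMVP (replicate n nothing) (allFinV n) α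
... | nothing = nothing
... | just occ with allFilled occ
...   | nothing = nothing
...   | just cs = just (Data.Vec.map (λ c → suc (toℕ c)) cs)

-- entry at (1-based) position j of the increasing k-cycle ⟨a, a+1, …, a+k-1⟩
-- in one-line notation (1,…,a-1, a+1,…,a+k-1, a, a+k,…,n)
cycleEntry : ℕ → ℕ → ℕ → ℕ
cycleEntry a k j with j <? a
... | yes _ = j
... | no _ with j <? a + k ∸ 1
...   | yes _ = suc j
...   | no _ with j <? a + k
...     | yes _ = a
...     | no _ = j

incCycle : (n a k : ℕ) → Vec ℕ n
incCycle n a k = tabulate (λ (s : Fin n) → cycleEntry a k (suc (toℕ s)))

-- Number cars and spots from 0 and write A = a − 1, K = k − 1. In the outcome, spots
-- A, …, A+K−1 hold cars A+1, …, A+K, spot A+K holds car A, and every other car is at its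
-- own spot. For t ≤ K, let car A prefer spot A + t and every other car prefer its final spot.
-- Under the MVP rule car A first parks at A + t and is then bumped one spot to the right by
-- each of the cars A+t+1, …, A+K, so these k distinct preference lists have the cycle as
-- outcome. Conversely, along any run every car sits at or after its preferred spot, and every
-- preferred spot is held by its car or by a later one. When the outcome is the cycle, these
-- two facts force every car other than A to prefer its final spot, and car A to prefer one of
-- the spots A, …, A+K.

module Submission where

open import Defs
open import Data.Nat using (ℕ; suc; pred; _+_; _∸_; _⊔_; _≤_; _<_; z≤n; s≤s)
open import Data.Nat.Properties
open import Data.Fin using (Fin; toℕ; fromℕ<) renaming (zero to fzero; suc to fsuc)
open import Data.Fin.Properties using (toℕ-injective; toℕ-fromℕ<; toℕ<n) renaming (_≟_ to _≟ᶠ_)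
open import Data.Vec using (Vec; []; _∷_; lookup; _[_]≔_; replicate; tabulate)
open import Data.Vec.Properties using (lookup-replicate; lookup∘update; lookup∘update′; lookup∘tabulate; lookup-map; tabulate-cong; tabulate∘lookup)
open import Data.List as List using (List; filter; head; length)
open import Data.List.Membership.Propositional using (_∈_)
open import Data.List.Membership.Propositional.Properties using (∈-filter⁻; ∈-tabulate⁺; ∈-tabulate⁻)
open import Data.List.Properties using (length-tabulate)
open import Data.List.Relation.Unary.Any using (here)
open import Data.List.Relation.Unary.Unique.Propositional using (Unique)
open import Data.List.Relation.Unary.Unique.Propositional.Properties using (tabulate⁺)
open import Data.Maybe as Maybe using (Maybe; just; nothing; is-nothing)
open import Data.Maybe.Properties using (just-injective)
open import Data.Bool using (T)
open import Data.Product using (Σ; ∃; _×_; _,_; proj₁; proj₂)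
open import Data.Sum using (_⊎_; inj₁; inj₂; map₂)
open import Data.Unit using (⊤; tt)
open import Function using (_∘_)
open import Function.Bundles using (_⇔_; mk⇔)
open import Level using (0ℓ)
open import Relation.Binary using (tri<; tri≈; tri>)
open import Relation.Binary.PropositionalEquality
open import Relation.Nullary using (¬_; Dec; yes; no; contradiction)
open import Relation.Unary using (Pred; Decidable)

head-∈ : ∀ {A : Set} {xs : List A} {x} → head xs ≡ just x → x ∈ xs
head-∈ {xs = _ List.∷ _} refl = here refl

module _ {A : Set} {P Q : Pred A 0ℓ} (P? : Decidable P) (Q? : Decidable Q) where

  head-filter²-sound : ∀ {xs x} → head (filter P? (filter Q? xs)) ≡ just x → P x × Q x
  head-filter²-sound {xs} h with ∈-filter⁻ P? {xs = filter Q? xs} (head-∈ h)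
  ... | x∈Qxs , Px = Px , proj₂ (∈-filter⁻ Q? {xs = xs} x∈Qxs)

  head-filter²-tabulate : ∀ {N} (g : Fin N → A) i → P (g i) → Q (g i) →
    (∀ j → toℕ j < toℕ i → ¬ P (g j)) →
    head (filter P? (filter Q? (List.tabulate g))) ≡ just (g i)
  head-filter²-tabulate g fzero Pgi Qgi _ with Q? (g fzero)
  ... | no ¬Q = contradiction Qgi ¬Q
  ... | yes _ with P? (g fzero)
  ...   | no ¬P = contradiction Pgi ¬P
  ...   | yes _ = refl
  head-filter²-tabulate g (fsuc i) Pgi Qgi earlier with Q? (g fzero)
  ... | no _ = head-filter²-tabulate (g ∘ fsuc) i Pgi Qgi (λ j j<i → earlier (fsuc j) (s≤s j<i))
  ... | yes _ with P? (g fzero)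
  ...   | yes P0 = contradiction P0 (earlier fzero (s≤s z≤n))
  ...   | no _ = head-filter²-tabulate (g ∘ fsuc) i Pgi Qgi (λ j j<i → earlier (fsuc j) (s≤s j<i))

module _ {n : ℕ} where

  is-nothing⇒≡nothing : ∀ {A : Set} {m : Maybe A} → T (is-nothing m) → m ≡ nothing
  is-nothing⇒≡nothing {m = nothing} _ = refl

  firstFreeAfter-sound : ∀ (occ : Occ n) {p q} → firstFreeAfter occ p ≡ just q →
    toℕ p < toℕ q × lookup occ q ≡ nothing
  firstFreeAfter-sound occ h with head-filter²-sound _ _ {List.allFin n} h
  ... | p<q , free = p<q , is-nothing⇒≡nothing free

  firstFreeAfter-next : ∀ (occ : Occ n) {p q} → toℕ q ≡ suc (toℕ p) → lookup occ q ≡ nothing →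
    firstFreeAfter occ p ≡ just q
  firstFreeAfter-next occ {p} {q} q≡p+1 free =
    head-filter²-tabulate _ _ (λ x → x) q (≤-reflexive (sym q≡p+1)) (subst (T ∘ is-nothing) (sym free) tt)
      λ j j<q p<j → <-irrefl refl (<-≤-trans p<j (≤-pred (subst (toℕ j <_) q≡p+1 j<q)))

  parkMVP-free : ∀ (occ : Occ n) c p → lookup occ p ≡ nothing →
    parkMVP occ c p ≡ just (occ [ p ]≔ just c)
  parkMVP-free occ c p free rewrite free = refl

  parkMVP-bump : ∀ (occ : Occ n) c p {d q} → lookup occ p ≡ just d → firstFreeAfter occ p ≡ just q →
    parkMVP occ c p ≡ just ((occ [ p ]≔ just c) [ q ]≔ just d)
  parkMVP-bump occ c p taken next rewrite taken | next = refl

Layout : Set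
Layout = ℕ → Maybe ℕ

_[_↦_] : Layout → ℕ → ℕ → Layout
(f [ p ↦ v ]) x with x ≟ p
... | yes _ = just v
... | no _ = f x

↦-same : ∀ f p v → (f [ p ↦ v ]) p ≡ just v
↦-same f p v with p ≟ p
... | yes _ = refl
... | no p≢p = contradiction refl p≢p

↦-other : ∀ f {p x} v → x ≢ p → (f [ p ↦ v ]) x ≡ f x
↦-other f {p} {x} v x≢p with x ≟ p
... | yes x≡p = contradiction x≡p x≢p
... | no _ = refl

↦-cong : ∀ {f g} p v → f ≗ g → f [ p ↦ v ] ≗ g [ p ↦ v ]
↦-cong p v f≗g x with x ≟ p
... | yes _ = refl
... | no _ = f≗g x

↦-comm : ∀ f {p q} v w → p ≢ q → f [ p ↦ v ] [ q ↦ w ] ≗ f [ q ↦ w ] [ p ↦ v ]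
↦-comm f {p} {q} v w p≢q x = by-cases (x ≟ p) (x ≟ q)
  where
  by-cases : Dec (x ≡ p) → Dec (x ≡ q) → (f [ p ↦ v ] [ q ↦ w ]) x ≡ (f [ q ↦ w ] [ p ↦ v ]) x
  by-cases (yes refl) (yes refl) = contradiction refl p≢q
  by-cases (yes refl) (no _) =
    trans (↦-other _ w p≢q) (trans (↦-same f x v) (sym (↦-same _ x v)))
  by-cases (no x≢p) (yes refl) =
    trans (↦-same _ x w) (sym (trans (↦-other _ v x≢p) (↦-same f x w)))
  by-cases (no x≢p) (no x≢q) =
    trans (↦-other _ w x≢q) (trans (↦-other f v x≢p) (sym (trans (↦-other _ v x≢p) (↦-other f w x≢q))))

↦-overwrite : ∀ f p v w → f [ p ↦ v ] [ p ↦ w ] ≗ f [ p ↦ w ]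
↦-overwrite f p v w x = by-cases (x ≟ p)
  where
  by-cases : Dec (x ≡ p) → (f [ p ↦ v ] [ p ↦ w ]) x ≡ (f [ p ↦ w ]) x
  by-cases (yes refl) = trans (↦-same _ x w) (sym (↦-same f x w))
  by-cases (no x≢p) = trans (↦-other _ w x≢p) (trans (↦-other f v x≢p) (sym (↦-other f w x≢p)))

prefix : (ℕ → ℕ) → ℕ → Layout
prefix g m x with x <? m
... | yes _ = just (g x)
... | no _ = nothing

prefix-< : ∀ g {m x} → x < m → prefix g m x ≡ just (g x)
prefix-< g {m} {x} x<m with x <? m
... | yes _ = refl
... | no x≮m = contradiction x<m x≮m

prefix-≥ : ∀ g {m x} → m ≤ x → prefix g m x ≡ nothing
prefix-≥ g {m} {x} m≤x with x <? m
... | yes x<m = contradiction m≤x (<⇒≱ x<m)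
... | no _ = refl

prefix-extend : ∀ g {m v} → g m ≡ v → prefix g m [ m ↦ v ] ≗ prefix g (suc m)
prefix-extend g {m} refl x = by-cases (x ≟ m)
  where
  by-cases : Dec (x ≡ m) → (prefix g m [ m ↦ g m ]) x ≡ prefix g (suc m) x
  by-cases (yes refl) = trans (↦-same _ x (g x)) (sym (prefix-< g (n<1+n x)))
  by-cases (no x≢m) with <-cmp x m
  ... | tri< x<m _ _ = trans (↦-other _ _ x≢m) (trans (prefix-< g x<m) (sym (prefix-< g (m<n⇒m<1+n x<m))))
  ... | tri≈ _ x≡m _ = contradiction x≡m x≢m
  ... | tri> _ _ m<x = trans (↦-other _ _ x≢m) (trans (prefix-≥ g (<⇒≤ m<x)) (sym (prefix-≥ g m<x)))

module _ {n : ℕ} where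

  record Describes (f : Layout) (occ : Occ n) : Set where
    constructor describes
    field at : ∀ s → Maybe.map toℕ (lookup occ s) ≡ f (toℕ s)
  open Describes public

  describes-cong : ∀ {f g} {occ : Occ n} → f ≗ g → Describes f occ → Describes g occ
  describes-cong f≗g D = describes λ s → trans (at D s) (f≗g (toℕ s))

  describes-prefix : ∀ g {occ : Occ n} → Describes (prefix g n) occ → Describes (just ∘ g) occ
  describes-prefix g D = describes λ s → trans (at D s) (prefix-< g (toℕ<n s))

  describes-free : ∀ {f} {occ : Occ n} {s} → Describes f occ → f (toℕ s) ≡ nothing → lookup occ s ≡ nothing
  describes-free {occ = occ} {s} D fs≡nothing with lookup occ s | at D s
  ... | nothing | _ = refl
  ... | just _ | just≡ = contradiction (trans just≡ fs≡nothing) λ ()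

  describes-taken : ∀ {f} {occ : Occ n} {s v} → Describes f occ → f (toℕ s) ≡ just v →
    Σ (Fin n) λ d → lookup occ s ≡ just d × toℕ d ≡ v
  describes-taken {occ = occ} {s} D fs≡v with lookup occ s | at D s
  ... | just d | just≡ = d , refl , just-injective (trans just≡ fs≡v)
  ... | nothing | nothing≡ = contradiction (trans nothing≡ fs≡v) λ ()

  describes-update : ∀ {f} {occ : Occ n} p c → Describes f occ →
    Describes (f [ toℕ p ↦ toℕ c ]) (occ [ p ]≔ just c)
  describes-update {f} {occ} p c D = describes at′
    where
    at′ : ∀ s → Maybe.map toℕ (lookup (occ [ p ]≔ just c) s) ≡ (f [ toℕ p ↦ toℕ c ]) (toℕ s)
    at′ s with s ≟ᶠ p
    ... | yes refl = trans (cong (Maybe.map toℕ) (lookup∘update s occ (just c))) (sym (↦-same f (toℕ s) (toℕ c)))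
    ... | no s≢p = trans (cong (Maybe.map toℕ) (lookup∘update′ s≢p occ (just c)))
                     (trans (at D s) (sym (↦-other f (toℕ c) (s≢p ∘ toℕ-injective))))

  park-into-free : ∀ {f} {occ : Occ n} c p {x v} → toℕ p ≡ x → toℕ c ≡ v →
    Describes f occ → f x ≡ nothing →
    Σ (Occ n) λ occ′ → parkMVP occ c p ≡ just occ′ × Describes (f [ x ↦ v ]) occ′
  park-into-free c p refl refl D free = _ , parkMVP-free _ c p (describes-free D free) , describes-update p c D

  park-bumping : ∀ {f} {occ : Occ n} c p {x v w} → toℕ p ≡ x → toℕ c ≡ v →
    Describes f occ → f x ≡ just w → f (suc x) ≡ nothing → suc x < n →
    Σ (Occ n) λ occ′ → parkMVP occ c p ≡ just occ′ × Describes (f [ x ↦ v ] [ suc x ↦ w ]) occ′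
  park-bumping {f} {occ} c p refl refl D taken next-free next with describes-taken D taken
  ... | d , occ-p≡d , refl =
    occ′ , parkMVP-bump occ c p occ-p≡d (firstFreeAfter-next occ (toℕ-fromℕ< next) (describes-free D q-free)) ,
    subst (λ x → Describes (f [ toℕ p ↦ toℕ c ] [ x ↦ toℕ d ]) occ′) (toℕ-fromℕ< next)
      (describes-update q d (describes-update p c D))
    where
    q : Fin n
    q = fromℕ< next
    occ′ : Occ n
    occ′ = (occ [ p ]≔ just c) [ q ]≔ just d
    q-free : f (toℕ q) ≡ nothing
    q-free = trans (cong f (toℕ-fromℕ< next)) next-free

  allFilled-lookup : ∀ {m} (v : Vec (Maybe (Fin n)) m) {cs} → allFilled v ≡ just cs →
    ∀ i → lookup v i ≡ just (lookup cs i)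
  allFilled-lookup (nothing ∷ v) ()
  allFilled-lookup (just c ∷ v) h i with allFilled v in filled
  allFilled-lookup (just c ∷ v) refl fzero | just _ = refl
  allFilled-lookup (just c ∷ v) refl (fsuc i) | just _ = allFilled-lookup v filled i

  allFilled-complete : ∀ {m} (v : Vec (Maybe (Fin n)) m) → (∀ i → ∃ λ c → lookup v i ≡ just c) →
    ∃ λ cs → allFilled v ≡ just cs
  allFilled-complete [] _ = [] , refl
  allFilled-complete (x ∷ v) full with full fzero | allFilled-complete v (full ∘ fsuc)
  ... | c , refl | cs , filled rewrite filled = c ∷ cs , refl

  initial : Occ n
  initial = replicate n nothing

  run : Vec (Fin n) n → Maybe (Occ n)
  run = runMVP initial (allFinV n)

  outcome-sound : ∀ α {occ} g → run α ≡ just occ → Describes (just ∘ g) occ →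
    outcomeMVP α ≡ just (tabulate (λ s → suc (g (toℕ s))))
  outcome-sound α {occ} g ran D with allFilled-complete occ (λ s → let d , e , _ = describes-taken D refl in d , e)
  ... | cs , filled rewrite ran | filled =
    cong just (trans (sym (tabulate∘lookup _)) (tabulate-cong λ s →
      trans (lookup-map s _ cs) (cong suc (just-injective
        (trans (cong (Maybe.map toℕ) (sym (allFilled-lookup occ filled s))) (at D s))))))

  outcome-complete : ∀ α g → outcomeMVP α ≡ just (tabulate (λ s → suc (g (toℕ s)))) →
    Σ (Occ n) λ occ → run α ≡ just occ × Describes (just ∘ g) occ
  outcome-complete α g h with run α in ran
  ... | just occ with allFilled occ in filled
  ...   | just cs = occ , refl , describes λ s →
          trans (cong (Maybe.map toℕ) (allFilled-lookup occ filled s))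
            (cong just (suc-injective (trans (sym (lookup-map s _ cs))
              (trans (cong (λ v → lookup v s) (just-injective h)) (lookup∘tabulate _ s)))))

module Runs {n : ℕ} (α : Vec (Fin n) n) where

  Arriving : ∀ {r} → ℕ → Vec (Fin n) r → Vec (Fin n) r → Set
  Arriving m [] [] = ⊤
  Arriving m (c ∷ cs) (p ∷ ps) = toℕ c ≡ m × p ≡ lookup α c × Arriving (suc m) cs ps

  arriving-tabulate : ∀ {r} m (f : Fin r → Fin n) ps → (∀ i → toℕ (f i) ≡ m + toℕ i) →
    (∀ i → lookup ps i ≡ lookup α (f i)) → Arriving m (tabulate f) ps
  arriving-tabulate m f [] _ _ = tt
  arriving-tabulate m f (p ∷ ps) numbered prefers =
    trans (numbered fzero) (+-identityʳ m) , prefers fzero ,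
    arriving-tabulate (suc m) (f ∘ fsuc) ps (λ i → trans (numbered (fsuc i)) (+-suc m (toℕ i))) (prefers ∘ fsuc)

  arriving-all : Arriving 0 (allFinV n) α
  arriving-all = arriving-tabulate 0 (λ c → c) α (λ _ → refl) (λ _ → refl)

  Parks : (ℕ → Occ n → Set) → ℕ → Occ n → Fin n → Set
  Parks Q m occ c = Σ (Occ n) λ occ′ → parkMVP occ c (lookup α c) ≡ just occ′ × Q (suc m) occ′

  run-progress : (Q : ℕ → Occ n → Set) → (∀ m occ c → toℕ c ≡ m → Q m occ → Parks Q m occ c) →
    ∀ {r} m occ (cs ps : Vec (Fin n) r) → Arriving m cs ps → Q m occ →
    Σ (Occ n) λ occ′ → runMVP occ cs ps ≡ just occ′ × Q (m + r) occ′
  run-progress Q step m occ [] [] _ q = occ , refl , subst (λ m → Q m occ) (sym (+-identityʳ m)) q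
  run-progress Q step m occ (c ∷ cs) (_ ∷ ps) (c≡m , refl , arriving) q with step m occ c c≡m q
  ... | occ₁ , parked , q₁ rewrite parked with run-progress Q step (suc m) occ₁ cs ps arriving q₁
  ...   | occ₂ , ran , q₂ = occ₂ , ran , subst (λ m → Q m occ₂) (sym (+-suc m _)) q₂

  run-preserves : (Q : ℕ → Occ n → Set) →
    (∀ m occ c occ′ → toℕ c ≡ m → Q m occ → parkMVP occ c (lookup α c) ≡ just occ′ → Q (suc m) occ′) →
    ∀ {r} m occ {occ′} (cs ps : Vec (Fin n) r) → Arriving m cs ps → Q m occ →
    runMVP occ cs ps ≡ just occ′ → Q (m + r) occ′
  run-preserves Q step m occ [] [] _ q refl = subst (λ m → Q m occ) (sym (+-identityʳ m)) q
  run-preserves Q step m occ {occ′} (c ∷ cs) (_ ∷ ps) (c≡m , refl , arriving) q ran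
    with parkMVP occ c (lookup α c) in parked
  ... | just occ₁ = subst (λ m → Q m occ′) (sym (+-suc m _))
          (run-preserves Q step (suc m) occ₁ cs ps arriving (step m occ c occ₁ c≡m q parked) ran)

module _ {a k j : ℕ} where

  cycleEntry-below : j < a → cycleEntry a k j ≡ j
  cycleEntry-below j<a with j <? a
  ... | yes _ = refl
  ... | no j≮a = contradiction j<a j≮a

  cycleEntry-cycle : a ≤ j → j < a + k ∸ 1 → cycleEntry a k j ≡ suc j
  cycleEntry-cycle a≤j j<end with j <? a
  ... | yes j<a = contradiction a≤j (<⇒≱ j<a)
  ... | no _ with j <? a + k ∸ 1
  ...   | yes _ = refl
  ...   | no j≮end = contradiction j<end j≮end

  cycleEntry-last : a ≤ j → a + k ∸ 1 ≤ j → j < a + k → cycleEntry a k j ≡ a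
  cycleEntry-last a≤j end≤j j<a+k with j <? a
  ... | yes j<a = contradiction a≤j (<⇒≱ j<a)
  ... | no _ with j <? a + k ∸ 1
  ...   | yes j<end = contradiction end≤j (<⇒≱ j<end)
  ...   | no _ with j <? a + k
  ...     | yes _ = refl
  ...     | no j≮a+k = contradiction j<a+k j≮a+k

  cycleEntry-above : a + k ≤ j → cycleEntry a k j ≡ j
  cycleEntry-above a+k≤j with j <? a
  ... | yes j<a = contradiction (≤-trans (m≤m+n a k) a+k≤j) (<⇒≱ j<a)
  ... | no _ with j <? a + k ∸ 1
  ...   | yes j<end = contradiction (≤-trans (m∸n≤m (a + k) 1) a+k≤j) (<⇒≱ j<end)
  ...   | no _ with j <? a + k
  ...     | yes j<a+k = contradiction a+k≤j (<⇒≱ j<a+k)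
  ...     | no _ = refl

-- car-at is the cycle in one-line notation with 0-based entries, and spot-of its inverse.
module Cycle (A K : ℕ) where

  car-at : ℕ → ℕ
  car-at x with x <? A
  ... | yes _ = x
  ... | no _ with x <? A + K
  ...   | yes _ = suc x
  ...   | no _ with x ≟ A + K
  ...     | yes _ = A
  ...     | no _ = x

  spot-of : ℕ → ℕ
  spot-of c with c <? A
  ... | yes _ = c
  ... | no _ with c ≟ A
  ...   | yes _ = A + K
  ...   | no _ with c ≤? A + K
  ...     | yes _ = pred c
  ...     | no _ = c

  pref : ℕ → ℕ → ℕ
  pref t c with c ≟ A
  ... | yes _ = A + t
  ... | no _ = spot-of c

  car-at-below : ∀ {x} → x < A → car-at x ≡ x
  car-at-below {x} x<A with x <? A
  ... | yes _ = refl
  ... | no x≮A = contradiction x<A x≮A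

  car-at-cycle : ∀ {x} → A ≤ x → x < A + K → car-at x ≡ suc x
  car-at-cycle {x} A≤x x<A+K with x <? A
  ... | yes x<A = contradiction A≤x (<⇒≱ x<A)
  ... | no _ with x <? A + K
  ...   | yes _ = refl
  ...   | no x≮A+K = contradiction x<A+K x≮A+K

  car-at-last : car-at (A + K) ≡ A
  car-at-last with A + K <? A
  ... | yes A+K<A = contradiction A+K<A (m+n≮m A K)
  ... | no _ with A + K <? A + K
  ...   | yes A+K<A+K = contradiction A+K<A+K (n≮n _)
  ...   | no _ with A + K ≟ A + K
  ...     | yes _ = refl
  ...     | no A+K≢A+K = contradiction refl A+K≢A+K

  car-at-above : ∀ {x} → A + K < x → car-at x ≡ x
  car-at-above {x} A+K<x with x <? A
  ... | yes x<A = contradiction (<-trans A+K<x x<A) (m+n≮m A K)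
  ... | no _ with x <? A + K
  ...   | yes x<A+K = contradiction x<A+K (<-asym A+K<x)
  ...   | no _ with x ≟ A + K
  ...     | yes x≡A+K = contradiction x≡A+K (>⇒≢ A+K<x)
  ...     | no _ = refl

  spot-of-below : ∀ {c} → c < A → spot-of c ≡ c
  spot-of-below {c} c<A with c <? A
  ... | yes _ = refl
  ... | no c≮A = contradiction c<A c≮A

  spot-of-first : spot-of A ≡ A + K
  spot-of-first with A <? A
  ... | yes A<A = contradiction A<A (n≮n A)
  ... | no _ with A ≟ A
  ...   | yes _ = refl
  ...   | no A≢A = contradiction refl A≢A

  spot-of-cycle : ∀ {c} → A < c → c ≤ A + K → spot-of c ≡ pred c
  spot-of-cycle {c} A<c c≤A+K with c <? A
  ... | yes c<A = contradiction c<A (<-asym A<c)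
  ... | no _ with c ≟ A
  ...   | yes c≡A = contradiction c≡A (>⇒≢ A<c)
  ...   | no _ with c ≤? A + K
  ...     | yes _ = refl
  ...     | no c≰A+K = contradiction c≤A+K c≰A+K

  spot-of-above : ∀ {c} → A + K < c → spot-of c ≡ c
  spot-of-above {c} A+K<c with c <? A
  ... | yes c<A = contradiction (<-trans A+K<c c<A) (m+n≮m A K)
  ... | no _ with c ≟ A
  ...   | yes refl = contradiction A+K<c (m+n≮m A K)
  ...   | no _ with c ≤? A + K
  ...     | yes c≤A+K = contradiction c≤A+K (<⇒≱ A+K<c)
  ...     | no _ = refl

  pref-first : ∀ t → pref t A ≡ A + t
  pref-first t with A ≟ A
  ... | yes _ = refl
  ... | no A≢A = contradiction refl A≢A

  pref-other : ∀ t {c} → c ≢ A → pref t c ≡ spot-of c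
  pref-other t {c} c≢A with c ≟ A
  ... | yes c≡A = contradiction c≡A c≢A
  ... | no _ = refl

  data CarRegion : ℕ → Set where
    before  : ∀ {c} → c < A → CarRegion c
    first   : CarRegion A
    shifted : ∀ {c} → A ≤ c → c < A + K → CarRegion (suc c)
    after   : ∀ {c} → A + K < c → CarRegion c

  car-region : ∀ c → CarRegion c
  car-region c with <-cmp c A
  ... | tri< c<A _ _ = before c<A
  ... | tri≈ _ refl _ = first
  car-region (suc c) | tri> _ _ (s≤s A≤c) with suc c ≤? A + K
  ...   | yes c<A+K = shifted A≤c c<A+K
  ...   | no c≮A+K = after (≰⇒> c≮A+K)

  data SpotRegion : ℕ → Set where
    below : ∀ {x} → x < A → SpotRegion x
    cycle : ∀ {x} → A ≤ x → x < A + K → SpotRegion x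
    last  : SpotRegion (A + K)
    above : ∀ {x} → A + K < x → SpotRegion x

  spot-region : ∀ x → SpotRegion x
  spot-region x with x <? A
  ... | yes x<A = below x<A
  ... | no x≮A with <-cmp x (A + K)
  ...   | tri< x<A+K _ _ = cycle (≮⇒≥ x≮A) x<A+K
  ...   | tri≈ _ refl _ = last
  ...   | tri> _ _ A+K<x = above A+K<x

  car-at-spot-of : ∀ c → car-at (spot-of c) ≡ c
  car-at-spot-of c with car-region c
  ... | before c<A rewrite spot-of-below c<A = car-at-below c<A
  ... | first rewrite spot-of-first = car-at-last
  ... | shifted A≤c c<A+K rewrite spot-of-cycle (s≤s A≤c) c<A+K = car-at-cycle A≤c c<A+K
  ... | after A+K<c rewrite spot-of-above A+K<c = car-at-above A+K<c

  car-at-≤-suc : ∀ x → car-at x ≤ suc x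
  car-at-≤-suc x with spot-region x
  ... | below x<A rewrite car-at-below x<A = n≤1+n x
  ... | cycle A≤x x<A+K rewrite car-at-cycle A≤x x<A+K = ≤-refl
  ... | last rewrite car-at-last = m≤n⇒m≤1+n (m≤m+n A K)
  ... | above A+K<x rewrite car-at-above A+K<x = n≤1+n x

  car-at-< : ∀ {x b} → x < b → A + K < b → car-at x < b
  car-at-< {x} x<b A+K<b with spot-region x
  ... | below x<A rewrite car-at-below x<A = x<b
  ... | cycle A≤x x<A+K rewrite car-at-cycle A≤x x<A+K = <-≤-trans (s≤s x<A+K) A+K<b
  ... | last rewrite car-at-last = ≤-<-trans (m≤m+n A K) A+K<b
  ... | above A+K<x rewrite car-at-above A+K<x = x<b

  car-at-before-spot-of : ∀ {c y} → c ≢ A → y < spot-of c → car-at y < c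
  car-at-before-spot-of {c} {y} c≢A y<c′ with car-region c
  ... | before c<A rewrite spot-of-below c<A | car-at-below (<-trans y<c′ c<A) = y<c′
  ... | first = contradiction refl c≢A
  ... | shifted A≤c c<A+K rewrite spot-of-cycle (s≤s A≤c) c<A+K = ≤-<-trans (car-at-≤-suc y) (s≤s y<c′)
  ... | after A+K<c rewrite spot-of-above A+K<c = car-at-< y<c′ A+K<c

  pref-pinned : ∀ {c y} → c ≢ A → c ≤ car-at y → y ≤ spot-of c → y ≡ spot-of c
  pref-pinned c≢A c≤car y≤spot with m≤n⇒m<n∨m≡n y≤spot
  ... | inj₁ y<spot = contradiction c≤car (<⇒≱ (car-at-before-spot-of c≢A y<spot))
  ... | inj₂ y≡spot = y≡spot

  A≤car-at⇒A≤ : ∀ {y} → A ≤ car-at y → A ≤ y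
  A≤car-at⇒A≤ {y} A≤car = ≮⇒≥ λ y<A → <⇒≱ y<A (subst (A ≤_) (car-at-below y<A) A≤car)

  Fixed : ℕ → Set
  Fixed x = x < A ⊎ A + K < x

  car-at-fixed : ∀ {x} → Fixed x → car-at x ≡ x
  car-at-fixed (inj₁ x<A) = car-at-below x<A
  car-at-fixed (inj₂ A+K<x) = car-at-above A+K<x

  pref-fixed : ∀ t {c} → Fixed c → pref t c ≡ c
  pref-fixed t (inj₁ c<A) = trans (pref-other t (<⇒≢ c<A)) (spot-of-below c<A)
  pref-fixed t (inj₂ A+K<c) = trans (pref-other t (>⇒≢ (≤-<-trans (m≤m+n A K) A+K<c))) (spot-of-above A+K<c)

  car-at-shifted : ∀ {j} → j < K → car-at (A + j) ≡ suc (A + j)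
  car-at-shifted {j} j<K = car-at-cycle (m≤m+n A j) (+-monoʳ-< A j<K)

  pref-shifted : ∀ t {j} → j < K → pref t (suc (A + j)) ≡ A + j
  pref-shifted t {j} j<K =
    trans (pref-other t (>⇒≢ (s≤s (m≤m+n A j)))) (spot-of-cycle (s≤s (m≤m+n A j)) (+-monoʳ-< A j<K))

  spot-of-< : ∀ {n c} → A + K < n → c < n → spot-of c < n
  spot-of-< {n} {c} A+K<n c<n with car-region c
  ... | before c<A rewrite spot-of-below c<A = c<n
  ... | first rewrite spot-of-first = A+K<n
  ... | shifted A≤c c<A+K rewrite spot-of-cycle (s≤s A≤c) c<A+K = <-trans (n<1+n _) c<n
  ... | after A+K<c rewrite spot-of-above A+K<c = c<n

  pref-< : ∀ {t n c} → t ≤ K → A + K < n → c < n → pref t c < n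
  pref-< {t} {n} {c} t≤K A+K<n c<n with c ≟ A
  ... | yes _ = ≤-<-trans (+-monoʳ-≤ A t≤K) A+K<n
  ... | no _ = spot-of-< A+K<n c<n

  cycleEntry-car-at : ∀ x → cycleEntry (suc A) (suc K) (suc x) ≡ suc (car-at x)
  cycleEntry-car-at x with spot-region x
  ... | below x<A rewrite car-at-below x<A = cycleEntry-below {k = suc K} (s≤s x<A)
  ... | cycle A≤x x<A+K rewrite car-at-cycle A≤x x<A+K =
          cycleEntry-cycle {k = suc K} (s≤s A≤x) (subst (suc x <_) (sym (+-suc A K)) (s≤s x<A+K))
  ... | last rewrite car-at-last =
          cycleEntry-last {k = suc K} (s≤s (m≤m+n A K)) (≤-reflexive (+-suc A K)) (s≤s (≤-reflexive (sym (+-suc A K))))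
  ... | above A+K<x rewrite car-at-above A+K<x =
          cycleEntry-above {suc A} {suc K} (s≤s (subst (_≤ x) (sym (+-suc A K)) A+K<x))

module Simulation (A K t : ℕ) (t≤K : t ≤ K) where
  open Cycle A K

  settled : ℕ → Layout
  settled = prefix car-at

  displaced : ℕ → Layout
  displaced j = settled (A + j) [ A + (t ⊔ j) ↦ A ]

  settled-first : settled A [ A + t ↦ A ] ≗ displaced 0
  settled-first rewrite +-identityʳ A | ⊔-identityʳ t = λ _ → refl

  displaced-pass : ∀ {j} → j < t →
    displaced j [ A + j ↦ suc (A + j) ] ≗ displaced (suc j)
  displaced-pass {j} j<t x
    rewrite m≥n⇒m⊔n≡m (<⇒≤ j<t) | m≥n⇒m⊔n≡m j<t | +-suc A j =
    trans (↦-comm _ A _ (>⇒≢ (+-monoʳ-< A j<t)) x)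
      (↦-cong (A + t) A (prefix-extend car-at (car-at-shifted (<-≤-trans j<t t≤K))) x)

  displaced-bump : ∀ {j} → t ≤ j → j < K →
    displaced j [ A + j ↦ suc (A + j) ] [ suc (A + j) ↦ A ] ≗ displaced (suc j)
  displaced-bump {j} t≤j j<K x
    rewrite m≤n⇒m⊔n≡n t≤j | m≤n⇒m⊔n≡n (m≤n⇒m≤1+n t≤j) | +-suc A j =
    trans (↦-cong (suc (A + j)) A (↦-overwrite _ (A + j) A _) x)
      (↦-cong (suc (A + j)) A (prefix-extend car-at (car-at-shifted j<K)) x)

  displaced-vacant : ∀ {j} → j < t → displaced j (A + j) ≡ nothing
  displaced-vacant {j} j<t =
    trans (↦-other _ A (<⇒≢ (+-monoʳ-< A (<-≤-trans j<t (m≤m⊔n t j))))) (prefix-≥ car-at ≤-refl)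

  displaced-first : ∀ {j} → t ≤ j → displaced j (A + j) ≡ just A
  displaced-first {j} t≤j =
    subst (λ i → displaced j (A + i) ≡ just A) (m≤n⇒m⊔n≡n t≤j) (↦-same _ (A + (t ⊔ j)) A)

  displaced-vacant-after : ∀ {j} → t ≤ j → displaced j (suc (A + j)) ≡ nothing
  displaced-vacant-after {j} t≤j =
    trans (↦-other _ A (>⇒≢ (s≤s (≤-reflexive (cong (A +_) (m≤n⇒m⊔n≡n t≤j)))))) (prefix-≥ car-at (n≤1+n _))

  displaced-last : displaced K ≗ settled (suc (A + K))
  displaced-last rewrite m≤n⇒m⊔n≡n t≤K = prefix-extend car-at car-at-last

  module _ {n : ℕ} (A+K<n : A + K < n) (α : Vec (Fin n) n)
           (prefers : ∀ c → toℕ (lookup α c) ≡ pref t (toℕ c)) where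
    open Runs α

    data Stage : ℕ → Occ n → Set where
      settling   : ∀ {m occ} → m ≤ A ⊎ A + K < m → Describes (settled m) occ → Stage m occ
      displacing : ∀ {j occ} → j ≤ K → Describes (displaced j) occ → Stage (suc (A + j)) occ

    step-fixed : ∀ {m occ c} → Fixed m → toℕ c ≡ m → Describes (settled m) occ → Parks Stage m occ c
    step-fixed {m} fixed c≡m D
      with park-into-free _ _ (trans (prefers _) (trans (cong (pref t) c≡m) (pref-fixed t fixed))) c≡m D
             (prefix-≥ car-at ≤-refl)
    ... | occ′ , parked , D′ =
      occ′ , parked , settling (map₂ m<n⇒m<1+n fixed)
        (describes-cong (prefix-extend car-at (car-at-fixed fixed)) D′)

    step-first : ∀ {occ c} → toℕ c ≡ A → Describes (settled A) occ → Parks Stage A occ c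
    step-first c≡A D
      with park-into-free _ _ (trans (prefers _) (trans (cong (pref t) c≡A) (pref-first t))) c≡A D
             (prefix-≥ car-at (m≤m+n A t))
    ... | occ′ , parked , D′ =
      occ′ , parked , subst (λ m → Stage (suc m) occ′) (+-identityʳ A)
        (displacing z≤n (describes-cong settled-first D′))

    prefers-shifted : ∀ {j c} → j < K → toℕ c ≡ suc (A + j) → toℕ (lookup α c) ≡ A + j
    prefers-shifted {j} {c} j<K c≡ = trans (prefers c) (trans (cong (pref t) c≡) (pref-shifted t j<K))

    displacing-next : ∀ {j occ} → j < K → Describes (displaced (suc j)) occ → Stage (suc (suc (A + j))) occ
    displacing-next {j} {occ} j<K D = subst (λ m → Stage (suc m) occ) (+-suc A j) (displacing j<K D)

    step-pass : ∀ {j occ c} → j < t → toℕ c ≡ suc (A + j) → Describes (displaced j) occ →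
      Parks Stage (suc (A + j)) occ c
    step-pass {j} j<t c≡ D
      with park-into-free _ _ (prefers-shifted (<-≤-trans j<t t≤K) c≡) c≡ D (displaced-vacant j<t)
    ... | occ′ , parked , D′ =
      occ′ , parked , displacing-next (<-≤-trans j<t t≤K) (describes-cong (displaced-pass j<t) D′)

    step-bump : ∀ {j occ c} → t ≤ j → j < K → toℕ c ≡ suc (A + j) → Describes (displaced j) occ →
      Parks Stage (suc (A + j)) occ c
    step-bump {j} t≤j j<K c≡ D
      with park-bumping _ _ (prefers-shifted j<K c≡) c≡ D (displaced-first t≤j) (displaced-vacant-after t≤j)
             (≤-<-trans (+-monoʳ-< A j<K) A+K<n)
    ... | occ′ , parked , D′ = occ′ , parked , displacing-next j<K (describes-cong (displaced-bump t≤j j<K) D′)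

    step : ∀ m occ c → toℕ c ≡ m → Stage m occ → Parks Stage m occ c
    step m occ c c≡m (settling (inj₂ A+K<m) D) = step-fixed (inj₂ A+K<m) c≡m D
    step m occ c c≡m (settling (inj₁ m≤A) D) with m≤n⇒m<n∨m≡n m≤A
    ... | inj₁ m<A = step-fixed (inj₁ m<A) c≡m D
    ... | inj₂ refl = step-first c≡m D
    step _ occ c c≡ (displacing {j} j≤K D) with m≤n⇒m<n∨m≡n j≤K
    ... | inj₂ refl = step-fixed (inj₂ (n<1+n _)) c≡ (describes-cong displaced-last D)
    ... | inj₁ j<K with j <? t
    ...   | yes j<t = step-pass j<t c≡ D
    ...   | no j≮t = step-bump (≮⇒≥ j≮t) j<K c≡ D

    settled-at-end : ∀ {occ} → Stage n occ → Describes (settled n) occ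
    settled-at-end (settling _ D) = D
    settled-at-end (displacing {j} j≤K D) with m≤n⇒m<n∨m≡n j≤K
    ... | inj₂ refl = describes-cong displaced-last D
    ... | inj₁ j<K = contradiction A+K<n (<⇒≱ (s≤s (+-monoʳ-< A j<K)))

    simulation : outcomeMVP α ≡ just (tabulate (λ s → suc (car-at (toℕ s))))
    simulation with run-progress Stage step 0 initial (allFinV n) α arriving-all
                      (settling (inj₁ z≤n) (describes λ s → cong (Maybe.map toℕ) (lookup-replicate s nothing)))
    ... | occ , ran , stage = outcome-sound α car-at ran (describes-prefix car-at (settled-at-end stage))

module ParkingInvariant {n : ℕ} (α : Vec (Fin n) n) where
  open Runs α

  HeldByLater : Occ n → Fin n → Set
  HeldByLater occ c = ∃ λ d → lookup occ (lookup α c) ≡ just d × toℕ c ≤ toℕ d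

  record Invariant (m : ℕ) (occ : Occ n) : Set where
    field
      parked-after-preference : ∀ {s c} → lookup occ s ≡ just c → toℕ (lookup α c) ≤ toℕ s
      preference-held-later : ∀ {c} → toℕ c < m → HeldByLater occ c
  open Invariant public

  invariant-park : ∀ {m occ} c → toℕ c ≡ m → Invariant m occ → Invariant (suc m) (occ [ lookup α c ]≔ just c)
  invariant-park {m} {occ} c c≡m I = record { parked-after-preference = behind ; preference-held-later = held }
    where
    p : Fin n
    p = lookup α c
    behind : ∀ {s c′} → lookup (occ [ p ]≔ just c) s ≡ just c′ → toℕ (lookup α c′) ≤ toℕ s
    behind {s} h with s ≟ᶠ p
    ... | yes refl with trans (sym h) (lookup∘update s occ (just c))
    ...   | refl = ≤-refl
    behind {s} h | no s≢p = parked-after-preference I (trans (sym (lookup∘update′ s≢p occ (just c))) h)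
    held : ∀ {c₀} → toℕ c₀ < suc m → HeldByLater (occ [ p ]≔ just c) c₀
    held {c₀} c₀≤m with lookup α c₀ ≟ᶠ p
    ... | yes same = c , trans (cong (lookup (occ [ p ]≔ just c)) same) (lookup∘update p occ (just c)) ,
                     subst (toℕ c₀ ≤_) (sym c≡m) (≤-pred c₀≤m)
    ... | no other with m≤n⇒m<n∨m≡n (≤-pred c₀≤m)
    ...   | inj₂ c₀≡m = contradiction (cong (lookup α) (toℕ-injective (trans c₀≡m (sym c≡m)))) other
    ...   | inj₁ c₀<m with preference-held-later I c₀<m
    ...     | d , held-by-d , c₀≤d = d , trans (lookup∘update′ other occ (just c)) held-by-d , c₀≤d

  invariant-move : ∀ {m occ} q d → lookup occ q ≡ nothing → toℕ (lookup α d) ≤ toℕ q →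
    Invariant m occ → Invariant m (occ [ q ]≔ just d)
  invariant-move {m} {occ} q d free pref≤q I = record { parked-after-preference = behind ; preference-held-later = held }
    where
    behind : ∀ {s c′} → lookup (occ [ q ]≔ just d) s ≡ just c′ → toℕ (lookup α c′) ≤ toℕ s
    behind {s} h with s ≟ᶠ q
    ... | yes refl with trans (sym h) (lookup∘update s occ (just d))
    ...   | refl = pref≤q
    behind {s} h | no s≢q = parked-after-preference I (trans (sym (lookup∘update′ s≢q occ (just d))) h)
    held : ∀ {c₀} → toℕ c₀ < m → HeldByLater (occ [ q ]≔ just d) c₀
    held {c₀} c₀<m with preference-held-later I c₀<m
    ... | d′ , held-by-d′ , c₀≤d′ with lookup α c₀ ≟ᶠ q
    ...   | yes refl = contradiction (trans (sym held-by-d′) free) λ ()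
    ...   | no other = d′ , trans (lookup∘update′ other occ (just d)) held-by-d′ , c₀≤d′

  invariant-step : ∀ m occ c occ′ → toℕ c ≡ m → Invariant m occ →
    parkMVP occ c (lookup α c) ≡ just occ′ → Invariant (suc m) occ′
  invariant-step m occ c occ′ c≡m I parked with lookup occ (lookup α c) in taken
  ... | nothing with refl ← parked = invariant-park c c≡m I
  ... | just d with firstFreeAfter occ (lookup α c) in next
  ...   | just q with refl ← parked with firstFreeAfter-sound occ next
  ...     | p<q , q-free =
    invariant-move q d (trans (lookup∘update′ (λ q≡p → <⇒≢ p<q (cong toℕ (sym q≡p))) occ (just c)) q-free)
      (≤-trans (parked-after-preference I taken) (<⇒≤ p<q)) (invariant-park c c≡m I)

  invariant-initial : Invariant 0 (initial {n})
  invariant-initial = record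
    { parked-after-preference = λ {s} h → contradiction (trans (sym (lookup-replicate s nothing)) h) λ ()
    ; preference-held-later = λ () }

  invariant-final : ∀ {occ} → run α ≡ just occ → Invariant n occ
  invariant-final = run-preserves Invariant invariant-step 0 initial (allFinV n) α arriving-all invariant-initial

module Preferences {n : ℕ} (A K : ℕ) (A+K<n : A + K < n) where
  open Cycle A K

  preference-bounds : ∀ α → outcomeMVP α ≡ just (tabulate (λ s → suc (car-at (toℕ s)))) →
    ∀ c → toℕ c ≤ car-at (toℕ (lookup α c)) × toℕ (lookup α c) ≤ spot-of (toℕ c)
  preference-bounds α outcome c with outcome-complete α car-at outcome
  ... | occ , ran , D = held-by-later , behind-own-spot
    where
    open ParkingInvariant α
    I : Invariant n occ
    I = invariant-final ran
    held-by-later : toℕ c ≤ car-at (toℕ (lookup α c))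
    held-by-later with preference-held-later I (toℕ<n c)
    ... | d , held , c≤d = subst (toℕ c ≤_) (just-injective (trans (cong (Maybe.map toℕ) (sym held)) (at D _))) c≤d
    spot<n : spot-of (toℕ c) < n
    spot<n = spot-of-< A+K<n (toℕ<n c)
    spot : Fin n
    spot = fromℕ< spot<n
    behind-own-spot : toℕ (lookup α c) ≤ spot-of (toℕ c)
    behind-own-spot with describes-taken {s = spot} D refl
    ... | d , parked , d≡ with toℕ-injective {i = d} {c}
                                 (trans d≡ (trans (cong car-at (toℕ-fromℕ< spot<n)) (car-at-spot-of (toℕ c))))
    ...   | refl = subst (toℕ (lookup α d) ≤_) (toℕ-fromℕ< spot<n) (parked-after-preference I parked)

  prefs : Fin (suc K) → Vec (Fin n) n
  prefs t = tabulate λ c → fromℕ< (pref-< (≤-pred (toℕ<n t)) A+K<n (toℕ<n c))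

  toℕ-prefs : ∀ t c → toℕ (lookup (prefs t) c) ≡ pref (toℕ t) (toℕ c)
  toℕ-prefs t c = trans (cong toℕ (lookup∘tabulate _ c)) (toℕ-fromℕ< _)

  A<n : A < n
  A<n = ≤-<-trans (m≤m+n A K) A+K<n

  first-car : Fin n
  first-car = fromℕ< A<n

  toℕ-prefs-first : ∀ t → toℕ (lookup (prefs t) first-car) ≡ A + toℕ t
  toℕ-prefs-first t =
    trans (toℕ-prefs t first-car) (trans (cong (pref (toℕ t)) (toℕ-fromℕ< A<n)) (pref-first (toℕ t)))

  prefs-injective : ∀ {t t′} → prefs t ≡ prefs t′ → t ≡ t′
  prefs-injective {t} {t′} same = toℕ-injective (+-cancelˡ-≡ A _ _
    (trans (sym (toℕ-prefs-first t)) (trans (cong (λ α → toℕ (lookup α first-car)) same) (toℕ-prefs-first t′))))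

  incCycle-car-at : incCycle n (suc A) (suc K) ≡ tabulate (λ s → suc (car-at (toℕ s)))
  incCycle-car-at = tabulate-cong λ s → cycleEntry-car-at (toℕ s)

  prefs-sound : ∀ t → outcomeMVP (prefs t) ≡ just (incCycle n (suc A) (suc K))
  prefs-sound t = trans (Simulation.simulation A K (toℕ t) (≤-pred (toℕ<n t)) A+K<n (prefs t) (toℕ-prefs t))
                        (cong just (sym incCycle-car-at))

  module _ (α : Vec (Fin n) n) (outcome : outcomeMVP α ≡ just (incCycle n (suc A) (suc K))) where

    bounds : ∀ c → toℕ c ≤ car-at (toℕ (lookup α c)) × toℕ (lookup α c) ≤ spot-of (toℕ c)
    bounds = preference-bounds α (trans outcome (cong just incCycle-car-at))

    first-pref : ℕ
    first-pref = toℕ (lookup α first-car)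

    A≤first-pref : A ≤ first-pref
    A≤first-pref = A≤car-at⇒A≤ (subst (_≤ car-at first-pref) (toℕ-fromℕ< A<n) (proj₁ (bounds first-car)))

    first-pref≤A+K : first-pref ≤ A + K
    first-pref≤A+K =
      subst (first-pref ≤_) (trans (cong spot-of (toℕ-fromℕ< A<n)) spot-of-first) (proj₂ (bounds first-car))

    first-preference : ∃ λ (t : Fin (suc K)) → first-pref ≡ A + toℕ t
    first-preference with m≤n⇒∃[o]m+o≡n A≤first-pref
    ... | t , A+t≡x =
      fromℕ< (s≤s (+-cancelˡ-≤ A t K (subst (_≤ A + K) (sym A+t≡x) first-pref≤A+K))) ,
      trans (sym A+t≡x) (cong (A +_) (sym (toℕ-fromℕ< _)))

    prefs-complete : ∃ λ t → α ≡ prefs t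
    prefs-complete = t , trans (sym (tabulate∘lookup α)) (trans (tabulate-cong pinned) (tabulate∘lookup (prefs t)))
      where
      t : Fin (suc K)
      t = proj₁ first-preference
      pinned-toℕ : ∀ c → Dec (toℕ c ≡ A) → toℕ (lookup α c) ≡ pref (toℕ t) (toℕ c)
      pinned-toℕ c (yes c≡A) with refl ← toℕ-injective {i = c} {first-car} (trans c≡A (sym (toℕ-fromℕ< A<n))) =
        trans (proj₂ first-preference) (sym (trans (cong (pref (toℕ t)) c≡A) (pref-first (toℕ t))))
      pinned-toℕ c (no c≢A) =
        trans (pref-pinned c≢A (proj₁ (bounds c)) (proj₂ (bounds c))) (sym (pref-other (toℕ t) c≢A))
      pinned : ∀ c → lookup α c ≡ lookup (prefs t) c
      pinned c = toℕ-injective (trans (pinned-toℕ c (toℕ c ≟ A)) (sym (toℕ-prefs t c)))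

  ∈-prefs⇔outcome : ∀ α → (α ∈ List.tabulate prefs) ⇔ (outcomeMVP α ≡ just (incCycle n (suc A) (suc K)))
  ∈-prefs⇔outcome α = mk⇔
    (λ α∈ → let t , α≡ = ∈-tabulate⁻ {f = prefs} α∈ in subst (λ α → outcomeMVP α ≡ _) (sym α≡) (prefs-sound t))
    (λ outcome → let t , α≡ = prefs-complete α outcome in subst (_∈ _) (sym α≡) (∈-tabulate⁺ {f = prefs} t))

lemma3p16 : (n a k : ℕ) → 1 ≤ k → 1 ≤ a → a + k ∸ 1 ≤ n →
    Σ (List (Vec (Fin n) n)) (λ L →
      Unique L × length L ≡ k ×
      ((α : Vec (Fin n) n) → (α ∈ L) ⇔ (outcomeMVP α ≡ just (incCycle n a k))))
lemma3p16 n (suc A) (suc K) (s≤s z≤n) (s≤s z≤n) fits =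
  List.tabulate prefs , tabulate⁺ prefs-injective , length-tabulate prefs , ∈-prefs⇔outcome
  where
  A+K<n : A + K < n
  A+K<n = subst (_≤ n) (+-suc A K) fits
  open Preferences A K A+K<n
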